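{- Let $G$ be a graph such that the vertex set of every $4$-hole of $G$ is contained in some maximal strong module of $G$, and let $G[U]$ be a maximum induced interval subgraph of $G$. For any maximal strong module $M$ of $G$ with $M\cap U\ne\emptyset$, the set $M\cap U$ is a module of $G[U]$, and for every maximum induced interval subgraph $G[U_M]$ of $G[M]$, the graph $G[(U\setminus M)\cup U_M]$ is a maximum induced interval subgraph of $G$.
   Context: Graphs are finite, simple, undirected. A module of $G$ is a set $M\subseteq V(G)$ such that every vertex outside $M$ is adjacent to all or none of $M$. A module $M$ is strong if for every module $M'$ intersecting $M$ we have $M\subseteq M'$ or $M'\subseteq M$; a strong module $M\neq V(G)$ is maximal if the only strong module properly containing it is $V(G)$. A $4$-hole is an induced cycle on four vertices. A maximum induced interval subgraph of $G$ is an induced subgraph $G[U]$ that is an interval graph with $|U|$ maximum. -}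

module Defs where

open import Data.Nat using (ℕ; _≤_)
open import Data.Bool using (Bool; true; false)
open import Data.Fin using (Fin)
open import Data.Fin.Subset using (Subset; _∈_; _∉_; _⊆_; _⊂_; ⊤; ∣_∣; _∩_; Nonempty)
open import Data.Product using (_×_; Σ; ∃)
open import Data.Sum using (_⊎_)
open import Relation.Nullary using (¬_)
open import Relation.Binary.PropositionalEquality using (_≡_; _≢_)
open import Function.Bundles using (_⇔_)

record Graph (n : ℕ) : Set where
  field
    adj   : Fin n → Fin n → Bool
    sym   : ∀ u v → adj u v ≡ adj v u
    irrefl : ∀ v → adj v v ≡ false

open Graph public

module _ {n : ℕ} (G : Graph n) where

  Adj : Fin n → Fin n → Set
  Adj u v = adj G u v ≡ true

  ModuleIn : Subset n → Subset n → Set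
  ModuleIn W M =
    M ⊆ W ×
    (∀ x → x ∈ W → x ∉ M →
       (∀ y → y ∈ M → Adj x y) ⊎ (∀ y → y ∈ M → ¬ Adj x y))

  IsModule : Subset n → Set
  IsModule M = ModuleIn ⊤ M

  IsStrongModule : Subset n → Set
  IsStrongModule M =
    IsModule M ×
    (∀ M′ → IsModule M′ → Nonempty (M ∩ M′) → (M ⊆ M′ ⊎ M′ ⊆ M))

  IsMaximalStrongModule : Subset n → Set
  IsMaximalStrongModule M =
    IsStrongModule M × M ≢ ⊤ ×
    (∀ M′ → IsStrongModule M′ → M ⊂ M′ → M′ ≡ ⊤)

  IsHole4 : Fin n → Fin n → Fin n → Fin n → Set
  IsHole4 a b c d =
    a ≢ b × a ≢ c × a ≢ d × b ≢ c × b ≢ d × c ≢ d ×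
    Adj a b × Adj b c × Adj c d × Adj d a ×
    ¬ Adj a c × ¬ Adj b d

  IsIntervalIn : Subset n → Set
  IsIntervalIn U =
    Σ (Fin n → ℕ) λ l → Σ (Fin n → ℕ) λ r →
      (∀ v → v ∈ U → l v ≤ r v) ×
      (∀ u v → u ∈ U → v ∈ U → u ≢ v →
         (Adj u v ⇔ (l u ≤ r v × l v ≤ r u)))

  IsMaxIntervalIn : Subset n → Subset n → Set
  IsMaxIntervalIn W U =
    U ⊆ W × IsIntervalIn U ×
    (∀ U′ → U′ ⊆ W → IsIntervalIn U′ → ∣ U′ ∣ ≤ ∣ U ∣)

module Submission where

-- As every vertex outside M sees all of M or
-- none of it, G[U ∩ M] can be traded for any interval subgraph G[U_M] of G[M], and maximality gives
-- |U ∩ M| ≤ |U_M|; only the interval model needs care. Fix s ∈ M ∩ U. If U_M is a clique, all of U_M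
-- gets the interval of s. Otherwise U_M has non-adjacent p, q, and two non-adjacent neighbours a, b
-- of M outside M would form the 4-hole p a q b; the maximal strong module containing it meets M in p,
-- hence lies inside M, contradicting a ∉ M. So s and its neighbours in U − M form a clique of G[U],
-- and by Helly their intervals share a point t. After scaling the model of U by suc k, the slot
-- [(suc k) t, (suc k) t + k] meets exactly the intervals of these neighbours, and a model of G[U_M]
-- with end points at most k fits into it.

open import Defs
open import Level using (0ℓ)
open import Data.Nat using (ℕ; suc; _+_; _*_; _≤_; _<_; s≤s)
open import Data.Nat.Properties
  using (≤-reflexive; ≤-pred; +-comm; ≤-trans; m≤m+n; +-suc; +-monoʳ-≤; +-mono-≤; +-cancelˡ-≤; *-monoʳ-≤; *-suc; *-cancelˡ-<)
open import Data.Bool using (true)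
open import Data.Bool.Properties using () renaming (_≟_ to _≟ᵇ_)
open import Data.Fin using (Fin) renaming (_≟_ to _≟ᶠ_)
open import Data.Fin.Properties using (any?)
open import Data.Fin.Subset
  using (Subset; inside; outside; _∈_; _∉_; _⊆_; ⊤; ∣_∣; _∩_; _∪_; _─_; Nonempty)
open import Data.Fin.Subset.Properties
  using (_∈?_; ∈⊤; x∈p∩q⁺; x∈p∩q⁻; p∩q⊆p; p∩q⊆q; x∈p∪q⁻; p─q⊆p)
open import Data.List using (List; allFin; filter; map)
open import Data.List.Extrema.Nat using (argmax; argmax-all; f[xs]≤f[argmax]; max; xs≤max)
open import Data.List.Membership.Propositional.Properties using (∈-allFin; ∈-filter⁺; ∈-map⁺)
open import Data.List.Relation.Unary.All as All using ()
open import Data.List.Relation.Unary.All.Properties using (all-filter)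
open import Data.Vec using ([]; _∷_; here; there)
open import Data.Product using (_×_; Σ; ∃; ∃₂; _,_; proj₁; proj₂; swap)
open import Data.Product.Function.NonDependent.Propositional using (_×-⇔_)
open import Data.Sum using (_⊎_; inj₁; inj₂)
open import Data.Empty using (⊥-elim)
open import Function using (_∘_; const)
open import Function.Bundles using (_⇔_; mk⇔; Equivalence)
open import Function.Properties.Equivalence using () renaming (trans to ⇔-trans)
open import Relation.Nullary using (¬_; yes; no)
open import Relation.Nullary.Decidable using (_×-dec_; _⊎-dec_; ¬?)
open import Relation.Unary using (Pred; Decidable)
import Relation.Binary.PropositionalEquality as ≡
open ≡ using (_≡_; _≢_; refl; cong)

open Equivalence using (to; from)


x∈p─q⁻ : ∀ {n} {x : Fin n} (p q : Subset n) → x ∈ p ─ q → x ∈ p × x ∉ q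
x∈p─q⁻ p q x∈p─q = p─q⊆p p q x∈p─q , λ x∈q → x∉p─q q p x∈q x∈p─q
  where
  x∉p─q : ∀ {n} {x : Fin n} (q p : Subset n) → x ∈ q → x ∉ p ─ q
  x∉p─q (inside ∷ q) (_ ∷ p) here ()
  x∉p─q (_ ∷ q) (_ ∷ p) (there x∈q) (there x∈p─q) = x∉p─q q p x∈q x∈p─q

∣p∣≡∣p─q∣+∣p∩q∣ : ∀ {n} (p q : Subset n) → ∣ p ∣ ≡ ∣ p ─ q ∣ + ∣ p ∩ q ∣
∣p∣≡∣p─q∣+∣p∩q∣ []            []            = refl
∣p∣≡∣p─q∣+∣p∩q∣ (inside  ∷ p) (inside  ∷ q) =
  ≡.trans (cong suc (∣p∣≡∣p─q∣+∣p∩q∣ p q)) (≡.sym (+-suc _ _))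
∣p∣≡∣p─q∣+∣p∩q∣ (inside  ∷ p) (outside ∷ q) = cong suc (∣p∣≡∣p─q∣+∣p∩q∣ p q)
∣p∣≡∣p─q∣+∣p∩q∣ (outside ∷ p) (inside  ∷ q) = ∣p∣≡∣p─q∣+∣p∩q∣ p q
∣p∣≡∣p─q∣+∣p∩q∣ (outside ∷ p) (outside ∷ q) = ∣p∣≡∣p─q∣+∣p∩q∣ p q

∣p∪q∣≡∣p∣+∣q∣ : ∀ {n} (p q : Subset n) → (∀ {x} → x ∈ p → x ∉ q) → ∣ p ∪ q ∣ ≡ ∣ p ∣ + ∣ q ∣
∣p∪q∣≡∣p∣+∣q∣ []            []            _        = refl
∣p∪q∣≡∣p∣+∣q∣ (inside  ∷ p) (inside  ∷ q) disjoint = ⊥-elim (disjoint here here)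
∣p∪q∣≡∣p∣+∣q∣ (inside  ∷ p) (outside ∷ q) disjoint =
  cong suc (∣p∪q∣≡∣p∣+∣q∣ p q (λ x∈p x∈q → disjoint (there x∈p) (there x∈q)))
∣p∪q∣≡∣p∣+∣q∣ (outside ∷ p) (inside  ∷ q) disjoint =
  ≡.trans (cong suc (∣p∪q∣≡∣p∣+∣q∣ p q (λ x∈p x∈q → disjoint (there x∈p) (there x∈q))))
          (≡.sym (+-suc _ _))
∣p∪q∣≡∣p∣+∣q∣ (outside ∷ p) (outside ∷ q) disjoint =
  ∣p∪q∣≡∣p∣+∣q∣ p q (λ x∈p x∈q → disjoint (there x∈p) (there x∈q))

p─q∌r : ∀ {n} (p q r : Subset n) → r ⊆ q → ∀ {x} → x ∈ p ─ q → x ∉ r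
p─q∌r p q r r⊆q x∈p─q x∈r = proj₂ (x∈p─q⁻ p q x∈p─q) (r⊆q x∈r)

∣p∣≤∣p─q∪r∣ : ∀ {n} (p q r : Subset n) → r ⊆ q → ∣ p ∩ q ∣ ≤ ∣ r ∣ → ∣ p ∣ ≤ ∣ (p ─ q) ∪ r ∣
∣p∣≤∣p─q∪r∣ p q r r⊆q ∣p∩q∣≤∣r∣
  rewrite ∣p∣≡∣p─q∣+∣p∩q∣ p q | ∣p∪q∣≡∣p∣+∣q∣ (p ─ q) r (p─q∌r p q r r⊆q) =
  +-monoʳ-≤ ∣ p ─ q ∣ ∣p∩q∣≤∣r∣

+-≤⇔ : ∀ c {a b} → a ≤ b ⇔ c + a ≤ c + b
+-≤⇔ c = mk⇔ (+-monoʳ-≤ c) (+-cancelˡ-≤ c _ _)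

*-≤-+⇔ : ∀ k {a b} → a ≤ b ⇔ suc k * a ≤ suc k * b + k
*-≤-+⇔ k {a} {b} = mk⇔ (λ a≤b → ≤-trans (*-monoʳ-≤ (suc k) a≤b) (m≤m+n _ k)) scaled⇒
  where
  scaled⇒ : suc k * a ≤ suc k * b + k → a ≤ b
  scaled⇒ ka≤kb+k = ≤-pred (*-cancelˡ-< (suc k) a (suc b) ka<k[1+b])
    where
    ka<k[1+b] : suc k * a < suc k * suc b
    ka<k[1+b] rewrite *-suc (suc k) b = s≤s (≤-trans ka≤kb+k (≤-reflexive (+-comm _ k)))

squeeze⇔ : ∀ k {x y t a b} → a ≤ k → b ≤ k →
  (x ≤ t × t ≤ y) ⇔ (suc k * x ≤ suc k * t + b × suc k * t + a ≤ suc k * y + k)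
squeeze⇔ k {x} {y} {t} {a} {b} a≤k b≤k = mk⇔
  (λ (x≤t , t≤y) → ≤-trans (*-monoʳ-≤ (suc k) x≤t) (m≤m+n _ b) , +-mono-≤ (*-monoʳ-≤ (suc k) t≤y) a≤k)
  (λ (kx≤kt+b , kt+a≤ky+k) → from (*-≤-+⇔ k) (≤-trans kx≤kt+b (+-monoʳ-≤ _ b≤k)) ,
                              from (*-≤-+⇔ k) (≤-trans (m≤m+n _ a) kt+a≤ky+k))

bounded : ∀ {n} (f : Fin n → ℕ) → ∃ λ k → ∀ v → f v ≤ k
bounded {n} f = max 0 fs , λ v → All.lookup (xs≤max 0 fs) (∈-map⁺ f (∈-allFin v))
  where
  fs : List ℕ
  fs = map f (allFin n)

-- Helly's theorem on the line: the largest left end point is a common point.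
intervals-helly : ∀ {n p} {P : Pred (Fin n) p} → Decidable P → (l r : Fin n → ℕ) →
  (∀ u v → P u → P v → l u ≤ r v) → ∃ P → ∃ λ t → ∀ v → P v → l v ≤ t × t ≤ r v
intervals-helly {n} {P = P} P? l r meet (s , Ps) = l w , λ v Pv → l≤l[w] v Pv , meet w v Pw Pv
  where
  candidates : List (Fin n)
  candidates = filter P? (allFin n)
  w : Fin n
  w = argmax l s candidates
  Pw : P w
  Pw = argmax-all l Ps (all-filter P? (allFin n))
  l≤l[w] : ∀ v → P v → l v ≤ l w
  l≤l[w] v Pv = All.lookup (f[xs]≤f[argmax] s candidates) (∈-filter⁺ P? (∈-allFin v) Pv)

∈∉⇒≢ : ∀ {n} {M : Subset n} {x y} → x ∈ M → y ∉ M → x ≢ y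
∈∉⇒≢ x∈M y∉M refl = y∉M x∈M

Meets : ∀ {n} → (Fin n → ℕ) → (Fin n → ℕ) → Fin n → Fin n → Set
Meets l r u v = l u ≤ r v × l v ≤ r u

module _ {n : ℕ} (G : Graph n) where

  Adj-sym : ∀ {x y} → Adj G x y → Adj G y x
  Adj-sym {x} {y} = ≡.trans (sym G y x)

  Adj-sym⇔ : ∀ {x y} → Adj G x y ⇔ Adj G y x
  Adj-sym⇔ = mk⇔ Adj-sym Adj-sym

  IsClique : Subset n → Set
  IsClique A = ∀ x y → x ∈ A → y ∈ A → x ≢ y → Adj G x y

  NonEdgeIn : Subset n → Set
  NonEdgeIn A = ∃₂ λ p q → p ∈ A × q ∈ A × p ≢ q × ¬ Adj G p q

  isClique⊎nonEdge : ∀ A → IsClique A ⊎ NonEdgeIn A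
  isClique⊎nonEdge A with any? (λ p → any? (λ q →
    (p ∈? A) ×-dec (q ∈? A) ×-dec ¬? (p ≟ᶠ q) ×-dec ¬? (adj G p q ≟ᵇ true)))
  ... | yes (p , q , nonEdge) = inj₂ (p , q , nonEdge)
  ... | no ¬nonEdge = inj₁ clique
    where
    clique : IsClique A
    clique x y x∈A y∈A x≢y with adj G x y ≟ᵇ true
    ... | yes xy = xy
    ... | no ¬xy = ⊥-elim (¬nonEdge (x , y , x∈A , y∈A , x≢y , ¬xy))

  IsIntervalModel : Subset n → (Fin n → ℕ) → (Fin n → ℕ) → Set
  IsIntervalModel U l r =
    (∀ v → v ∈ U → l v ≤ r v) ×
    (∀ u v → u ∈ U → v ∈ U → u ≢ v → Adj G u v ⇔ Meets l r u v)

  model-⊆ : ∀ {U V l r} → V ⊆ U → IsIntervalModel U l r → IsIntervalModel V l r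
  model-⊆ V⊆U (l≤r , adj⇔) =
    (λ v v∈V → l≤r v (V⊆U v∈V)) , λ u v u∈V v∈V → adj⇔ u v (V⊆U u∈V) (V⊆U v∈V)

  model-shift : ∀ c {U l r} → IsIntervalModel U l r →
    IsIntervalModel U (λ v → c + l v) (λ v → c + r v)
  model-shift c (l≤r , adj⇔) =
    (λ v v∈U → to (+-≤⇔ c) (l≤r v v∈U)) ,
    λ u v u∈U v∈U u≢v → ⇔-trans (adj⇔ u v u∈U v∈U u≢v) (+-≤⇔ c ×-⇔ +-≤⇔ c)

  model-scale : ∀ k {U l r} → IsIntervalModel U l r →
    IsIntervalModel U (λ v → suc k * l v) (λ v → suc k * r v + k)
  model-scale k (l≤r , adj⇔) =
    (λ v v∈U → to (*-≤-+⇔ k) (l≤r v v∈U)) ,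
    λ u v u∈U v∈U u≢v → ⇔-trans (adj⇔ u v u∈U v∈U u≢v) (*-≤-+⇔ k ×-⇔ *-≤-+⇔ k)

  model-clique : ∀ {A a b} → IsClique A → a ≤ b → IsIntervalModel A (const a) (const b)
  model-clique clique a≤b =
    (λ _ _ → a≤b) , λ u v u∈A v∈A u≢v → mk⇔ (λ _ → a≤b , a≤b) (λ _ → clique u v u∈A v∈A u≢v)

  select : Subset n → (Fin n → ℕ) → (Fin n → ℕ) → Fin n → ℕ
  select A f g v with v ∈? A
  ... | yes _ = f v
  ... | no  _ = g v

  model-glue : ∀ {A B l₁ r₁ l₂ r₂} → IsIntervalModel A l₁ r₁ → IsIntervalModel B l₂ r₂ →
    (∀ x u → x ∈ B → u ∈ A → Adj G x u ⇔ (l₂ x ≤ r₁ u × l₁ u ≤ r₂ x)) →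
    IsIntervalModel (B ∪ A) (select A l₁ l₂) (select A r₁ r₂)
  model-glue {A} {B} {l₁} {r₁} {l₂} {r₂} (l₁≤r₁ , adj⇔₁) (l₂≤r₂ , adj⇔₂) across = l≤r , adj⇔
    where
    ∈B : ∀ {x} → x ∈ B ∪ A → x ∉ A → x ∈ B
    ∈B x∈B∪A x∉A with x∈p∪q⁻ B A x∈B∪A
    ... | inj₁ x∈B = x∈B
    ... | inj₂ x∈A = ⊥-elim (x∉A x∈A)
    l≤r : ∀ v → v ∈ B ∪ A → select A l₁ l₂ v ≤ select A r₁ r₂ v
    l≤r v v∈B∪A with v ∈? A
    ... | yes v∈A = l₁≤r₁ v v∈A
    ... | no  v∉A = l₂≤r₂ v (∈B v∈B∪A v∉A)
    adj⇔ : ∀ u v → u ∈ B ∪ A → v ∈ B ∪ A → u ≢ v →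
      Adj G u v ⇔ Meets (select A l₁ l₂) (select A r₁ r₂) u v
    adj⇔ u v u∈B∪A v∈B∪A u≢v with u ∈? A | v ∈? A
    ... | yes u∈A | yes v∈A = adj⇔₁ u v u∈A v∈A u≢v
    ... | no  u∉A | no  v∉A = adj⇔₂ u v (∈B u∈B∪A u∉A) (∈B v∈B∪A v∉A) u≢v
    ... | no  u∉A | yes v∈A = across u v (∈B u∈B∪A u∉A) v∈A
    ... | yes u∈A | no  v∉A =
      ⇔-trans Adj-sym⇔ (⇔-trans (across v u (∈B v∈B∪A v∉A) u∈A) (mk⇔ swap swap))

  clique-commonPoint : ∀ {U l r p} {C : Pred (Fin n) p} → IsIntervalModel U l r → Decidable C →
    (∀ {v} → C v → v ∈ U) → (∀ u v → C u → C v → u ≢ v → Adj G u v) → ∃ C →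
    ∃ λ t → ∀ v → C v → l v ≤ t × t ≤ r v
  clique-commonPoint {l = l} {r} {C = C} (l≤r , adj⇔) C? C⊆U clique = intervals-helly C? l r meet
    where
    meet : ∀ u v → C u → C v → l u ≤ r v
    meet u v Cu Cv with u ≟ᶠ v
    ... | yes refl = l≤r u (C⊆U Cu)
    ... | no  u≢v  = proj₁ (to (adj⇔ u v (C⊆U Cu) (C⊆U Cv) u≢v) (clique u v Cu Cv u≢v))

  module-∩ : ∀ {M U} → IsModule G M → ModuleIn G U (M ∩ U)
  module-∩ {M} {U} (_ , split) = p∩q⊆q M U , split∩
    where
    split∩ : ∀ x → x ∈ U → x ∉ M ∩ U →
      (∀ y → y ∈ M ∩ U → Adj G x y) ⊎ (∀ y → y ∈ M ∩ U → ¬ Adj G x y)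
    split∩ x x∈U x∉M∩U with split x ∈⊤ (λ x∈M → x∉M∩U (x∈p∩q⁺ (x∈M , x∈U)))
    ... | inj₁ all  = inj₁ λ y y∈M∩U → all y (proj₁ (x∈p∩q⁻ M U y∈M∩U))
    ... | inj₂ none = inj₂ λ y y∈M∩U → none y (proj₁ (x∈p∩q⁻ M U y∈M∩U))

  module-adj-all : ∀ {M x s} → IsModule G M → x ∉ M → s ∈ M → Adj G x s → ∀ u → u ∈ M → Adj G x u
  module-adj-all (_ , split) x∉M s∈M xs with split _ ∈⊤ x∉M
  ... | inj₁ all  = all
  ... | inj₂ none = ⊥-elim (none _ s∈M xs)

  module-adj⇔ : ∀ {M x u s} → IsModule G M → x ∉ M → u ∈ M → s ∈ M → Adj G x u ⇔ Adj G x s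
  module-adj⇔ M-module x∉M u∈M s∈M =
    mk⇔ (λ xu → module-adj-all M-module x∉M u∈M xu _ s∈M)
        (λ xs → module-adj-all M-module x∉M s∈M xs _ u∈M)

  maximalStrong-⊆ : ∀ {M M′} → IsMaximalStrongModule G M → IsMaximalStrongModule G M′ →
    Nonempty (M′ ∩ M) → M′ ⊆ M
  maximalStrong-⊆ {M} {M′} ((M-module , _) , _ , M-maximal) (M′-strong , M′≢⊤ , _) M′∩M≢∅ {x} x∈M′
    with proj₂ M′-strong M M-module M′∩M≢∅
  ... | inj₁ M′⊆M = M′⊆M x∈M′
  ... | inj₂ M⊆M′ with x ∈? M
  ...   | yes x∈M = x∈M
  ...   | no  x∉M = ⊥-elim (M′≢⊤ (M-maximal M′ M′-strong (M⊆M′ , x , x∈M′ , x∉M)))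

  Every4HoleInMaximalStrongModule : Set
  Every4HoleInMaximalStrongModule = ∀ a b c d → IsHole4 G a b c d →
    Σ (Subset n) λ M → IsMaximalStrongModule G M × a ∈ M × b ∈ M × c ∈ M × d ∈ M

  -- Otherwise p a q b would be a 4-hole sticking out of M.
  complete-to-nonEdge⇒adjacent : Every4HoleInMaximalStrongModule → ∀ {M a b} →
    IsMaximalStrongModule G M → NonEdgeIn M → a ∉ M → b ∉ M → a ≢ b →
    (∀ y → y ∈ M → Adj G a y) → (∀ y → y ∈ M → Adj G b y) → Adj G a b
  complete-to-nonEdge⇒adjacent holes {M} {a} {b} M-maximal (p , q , p∈M , q∈M , p≢q , ¬pq)
    a∉M b∉M a≢b a~M b~M with adj G a b ≟ᵇ true
  ... | yes ab = ab
  ... | no ¬ab with holes p a q b hole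
    where
    hole : IsHole4 G p a q b
    hole = ∈∉⇒≢ p∈M a∉M , p≢q , ∈∉⇒≢ p∈M b∉M ,
           (λ a≡q → ∈∉⇒≢ q∈M a∉M (≡.sym a≡q)) , a≢b , ∈∉⇒≢ q∈M b∉M ,
           Adj-sym (a~M p p∈M) , a~M q q∈M , Adj-sym (b~M q q∈M) , b~M p p∈M , ¬pq , ¬ab
  ... | M′ , M′-maximal , p∈M′ , a∈M′ , _ =
    ⊥-elim (a∉M (maximalStrong-⊆ M-maximal M′-maximal (p , x∈p∩q⁺ (p∈M′ , p∈M)) a∈M′))

  nonEdge-⊆ : ∀ {A B} → A ⊆ B → NonEdgeIn A → NonEdgeIn B
  nonEdge-⊆ A⊆B (p , q , p∈A , q∈A , nonEdge) = p , q , A⊆B p∈A , A⊆B q∈A , nonEdge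

module Replacement {n : ℕ} (G : Graph n) {U M : Subset n} {l r : Fin n → ℕ}
  (U-model : IsIntervalModel G U l r) (M-module : IsModule G M)
  {s : Fin n} (s∈M : s ∈ M) (s∈U : s ∈ U) {UM : Subset n} (UM⊆M : UM ⊆ M) where

  U─M⊆U : U ─ M ⊆ U
  U─M⊆U = p─q⊆p U M

  ∉M : ∀ {x} → x ∈ U ─ M → x ∉ M
  ∉M = proj₂ ∘ x∈p─q⁻ U M

  adj-UM⇔adj-s : ∀ x u → x ∈ U ─ M → u ∈ UM → Adj G x u ⇔ Adj G x s
  adj-UM⇔adj-s x u x∈U─M u∈UM = module-adj⇔ G M-module (∉M x∈U─M) (UM⊆M u∈UM) s∈M

  adj-s⇔meets : ∀ x → x ∈ U ─ M → Adj G x s ⇔ Meets l r x s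
  adj-s⇔meets x x∈U─M =
    proj₂ U-model x s (U─M⊆U x∈U─M) s∈U (λ x≡s → ∈∉⇒≢ s∈M (∉M x∈U─M) (≡.sym x≡s))

  clique-case : IsClique G UM → IsIntervalIn G ((U ─ M) ∪ UM)
  clique-case clique = _ , _ ,
    model-glue G (model-clique G clique (proj₁ U-model s s∈U)) (model-⊆ G U─M⊆U U-model)
      λ x u x∈U─M u∈UM → ⇔-trans (adj-UM⇔adj-s x u x∈U─M u∈UM) (adj-s⇔meets x x∈U─M)

  IsNeighbourhoodPoint : ℕ → Set
  IsNeighbourhoodPoint t = ∀ x → x ∈ U ─ M → Adj G x s ⇔ (l x ≤ t × t ≤ r x)

  spread-case : ∀ {l′ r′} → IsIntervalModel G UM l′ r′ → ∃ IsNeighbourhoodPoint →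
    IsIntervalIn G ((U ─ M) ∪ UM)
  spread-case {l′} {r′} UM-model (t , t-neighbourhood) = _ , _ ,
    model-glue G (model-shift G (suc k * t) UM-model) (model-scale G k (model-⊆ G U─M⊆U U-model))
      λ x u x∈U─M u∈UM →
        ⇔-trans (adj-UM⇔adj-s x u x∈U─M u∈UM)
        (⇔-trans (t-neighbourhood x x∈U─M)
                 (squeeze⇔ k (≤-trans (proj₁ UM-model u u∈UM) (r′≤k u)) (r′≤k u)))
    where
    k : ℕ
    k = proj₁ (bounded r′)
    r′≤k : ∀ u → r′ u ≤ k
    r′≤k = proj₂ (bounded r′)

  neighbourhoodPoint : Every4HoleInMaximalStrongModule G → IsMaximalStrongModule G M →
    NonEdgeIn G M → ∃ IsNeighbourhoodPoint
  neighbourhoodPoint holes M-maximal nonEdge = t , λ x x∈U─M →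
    mk⇔ (λ xs → t-common x (inj₂ (x∈U─M , xs)))
        (λ (lx≤t , t≤rx) → from (adj-s⇔meets x x∈U─M)
                             (≤-trans lx≤t (proj₂ t-s) , ≤-trans (proj₁ t-s) t≤rx))
    where
    C : Pred (Fin n) 0ℓ
    C v = v ≡ s ⊎ (v ∈ U ─ M × Adj G v s)
    C? : Decidable C
    C? v = (v ≟ᶠ s) ⊎-dec ((v ∈? (U ─ M)) ×-dec (adj G v s ≟ᵇ true))
    C⊆U : ∀ {v} → C v → v ∈ U
    C⊆U (inj₁ refl)        = s∈U
    C⊆U (inj₂ (v∈U─M , _)) = U─M⊆U v∈U─M
    adj-M : ∀ {v} → v ∈ U ─ M → Adj G v s → ∀ y → y ∈ M → Adj G v y
    adj-M v∈U─M vs = module-adj-all G M-module (∉M v∈U─M) s∈M vs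
    C-clique : ∀ u v → C u → C v → u ≢ v → Adj G u v
    C-clique u v (inj₁ refl)         (inj₁ refl)         u≢v = ⊥-elim (u≢v refl)
    C-clique u v (inj₁ refl)         (inj₂ (_ , vs))     _   = Adj-sym G vs
    C-clique u v (inj₂ (_ , us))     (inj₁ refl)         _   = us
    C-clique u v (inj₂ (u∈U─M , us)) (inj₂ (v∈U─M , vs)) u≢v =
      complete-to-nonEdge⇒adjacent G holes M-maximal nonEdge (∉M u∈U─M) (∉M v∈U─M) u≢v
        (adj-M u∈U─M us) (adj-M v∈U─M vs)
    common : ∃ λ t → ∀ v → C v → l v ≤ t × t ≤ r v
    common = clique-commonPoint G U-model C? C⊆U C-clique (s , inj₁ refl)
    t : ℕ
    t = proj₁ common
    t-common : ∀ v → C v → l v ≤ t × t ≤ r v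
    t-common = proj₂ common
    t-s : l s ≤ t × t ≤ r s
    t-s = t-common s (inj₁ refl)

theorem2p2 : ∀ {n : ℕ} (G : Graph n) →
    (∀ a b c d → IsHole4 G a b c d →
       Σ (Subset n) λ M → IsMaximalStrongModule G M ×
         a ∈ M × b ∈ M × c ∈ M × d ∈ M) →
    ∀ (U : Subset n) → IsMaxIntervalIn G ⊤ U →
    ∀ (M : Subset n) → IsMaximalStrongModule G M → Nonempty (M ∩ U) →
      ModuleIn G U (M ∩ U) ×
      (∀ (UM : Subset n) → IsMaxIntervalIn G M UM →
         IsMaxIntervalIn G ⊤ ((U ─ M) ∪ UM))
theorem2p2 G holes U (_ , (l , r , U-model) , U-maximum) M M-maximal@((M-module , _) , _)
  (_ , s∈M∩U) = module-∩ G M-module , replaced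
  where
  replaced : ∀ UM → IsMaxIntervalIn G M UM → IsMaxIntervalIn G ⊤ ((U ─ M) ∪ UM)
  replaced UM (UM⊆M , (_ , _ , UM-model) , UM-maximum) = (λ _ → ∈⊤) , interval , maximum
    where
    open Replacement G U-model M-module
      (proj₁ (x∈p∩q⁻ M U s∈M∩U)) (proj₂ (x∈p∩q⁻ M U s∈M∩U)) UM⊆M
    interval : IsIntervalIn G ((U ─ M) ∪ UM)
    interval with isClique⊎nonEdge G UM
    ... | inj₁ clique  = clique-case clique
    ... | inj₂ nonEdge = spread-case UM-model
                           (neighbourhoodPoint holes M-maximal (nonEdge-⊆ G UM⊆M nonEdge))
    U∩M≤UM : ∣ U ∩ M ∣ ≤ ∣ UM ∣
    U∩M≤UM = UM-maximum (U ∩ M) (p∩q⊆q U M) (l , r , model-⊆ G (p∩q⊆p U M) U-model)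
    maximum : ∀ U′ → U′ ⊆ ⊤ → IsIntervalIn G U′ → ∣ U′ ∣ ≤ ∣ (U ─ M) ∪ UM ∣
    maximum U′ U′⊆⊤ U′-interval =
      ≤-trans (U-maximum U′ U′⊆⊤ U′-interval) (∣p∣≤∣p─q∪r∣ U M UM UM⊆M U∩M≤UM)
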